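{- Let $k$ be an integer with $3\le k\le 5$, and for positive integers $m$ let $\frac{m(m+1)(m(k-2)-(k-5))}{6}$ be the $m$-th $k$-gonal pyramidal number. For a positive integer $n$ put $s=\left\lfloor\sqrt[3]{\frac{6n}{k-2}}\right\rfloor$. Then the $n$-th smallest positive integer that is not a $k$-gonal pyramidal number equals $$a(n)=\begin{cases} n+s-1 & \text{if } 6n\le s(s-1)\bigl(s(k-2)+k+1\bigr),\\ n+s & \text{otherwise.}\end{cases}$$ -}

module Defs where

open import Data.Nat using (ℕ; zero; suc; _+_; _*_; _∸_; _/_; _≤_; _<_)
open import Data.Fin using (Fin)
open import Data.Product using (Σ; ∃; ∃-syntax; _×_)
open import Relation.Nullary using (¬_)
open import Relation.Binary.PropositionalEquality using (_≡_)
open import Function.Bundles using (_⇔_)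

-- The m-th k-gonal pyramidal number  m(m+1)(m(k-2)-(k-5))/6.
-- For 3 ≤ k ≤ 5 we have -(k-5) = 5-k ≥ 0, so the third factor is m(k-2)+(5-k),
-- computed here with truncated subtraction (exact in that range).
pyr : ℕ → ℕ → ℕ
pyr k m = (m * (m + 1) * (m * (k ∸ 2) + (5 ∸ k))) / 6

Pyramidal : ℕ → ℕ → Set
Pyramidal k x = ∃[ m ] (1 ≤ m × pyr k m ≡ x)

NonPyramidal : ℕ → ℕ → Set
NonPyramidal k x = 1 ≤ x × ¬ Pyramidal k x

-- a is the n-th smallest element of S ⊆ ℕ:  a ∈ S and the elements of S
-- that are ≤ a are listed, strictly increasingly and exhaustively, by
-- some g : Fin n → ℕ (so there are exactly n of them, a being the largest).
NthSmallest : (ℕ → Set) → ℕ → ℕ → Set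
NthSmallest S n a =
  S a × Σ (Fin n → ℕ) λ g →
    (∀ i j → i Data.Fin.< j → g i < g j) ×
    (∀ x → (S x × x ≤ a) ⇔ (∃[ i ] g i ≡ x))

{-# OPTIONS --safe #-}
-- Write P = pyr k.  P is strictly increasing with P 0 = 0, so if P c < a < P (c + 1) then exactly
-- c of the numbers 1, …, a are pyramidal and a is the (a − c)-th non-pyramidal number.
-- With d = k − 2 we have P m = ⌊N m / 6⌋ for N m = m (m + 1) (m d + 5 − k), and
-- N (s − 1) < s³ d,   N s = s (s − 1) (s d + k + 1) + 6 s,   and (s + 1)³ d + 6 (s + 1) ≤ N (s + 1)
-- for s ≥ 1, all from polynomial identities in d and e = 5 − k together with d + e = 3.
-- So s³ d ≤ 6 n gives P (s − 1) < n, and comparing 6 n with s (s − 1) (s d + k + 1) decides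
-- whether a = n + s − 1 lies below P s or a = n + s lies above it; in the latter case
-- 6 n < (s + 1)³ d keeps a below P (s + 1).
module Submission where

open import Defs
open import Data.Nat
  using (ℕ; zero; suc; _+_; _*_; _∸_; _^_; _/_; _≤_; _<_; _<′_; z≤n; s≤s; <′-base; <′-step; NonZero; _≟_)
open import Data.Nat.Properties
open import Data.Nat.DivMod using (m*n/n≡m; /-monoˡ-≤; m/n*n≤m; m<n*o⇒m/o<n)
open import Data.Nat.Tactic.RingSolver using (solve-∀)
open import Data.Fin using (toℕ; fromℕ<)
open import Data.Fin.Properties using (toℕ<n; toℕ-fromℕ<)
open import Data.Product using (∃-syntax; ∃₂; _×_; _,_; proj₂; map₂)
open import Data.Sum using (_⊎_; inj₁; inj₂)
open import Function.Base using (_∘_)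
open import Function.Bundles using (mk⇔)
open import Relation.Nullary using (¬_; yes; no; contradiction)
open import Relation.Binary.Definitions using (tri<; tri≈; tri>)
open import Relation.Binary.PropositionalEquality

m*n≤o⇒m≤o/n : ∀ m {n o} .{{_ : NonZero n}} → m * n ≤ o → m ≤ o / n
m*n≤o⇒m≤o/n m {n} m*n≤o = subst (_≤ _ / n) (m*n/n≡m m n) (/-monoˡ-≤ n m*n≤o)

m^3≡m*m*m : ∀ m → m ^ 3 ≡ m * m * m
m^3≡m*m*m m = trans (cong (λ x → m * (m * x)) (*-identityʳ m)) (sym (*-assoc m m m))

-- Indexed by ℕ rather than by Fin n, so that a listing can be extended by one entry.
record Listing (S : ℕ → Set) (a n : ℕ) : Set where
  field
    g          : ℕ → ℕ
    increasing : ∀ {i j} → i < j → j < n → g i < g j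
    complete   : ∀ {x} → S x → x ≤ a → ∃[ i ] (i < n × g i ≡ x)
    sound      : ∀ {i} → i < n → S (g i) × g i ≤ a

module _ {S : ℕ → Set} where

  listing-zero : ¬ S 0 → Listing S 0 0
  listing-zero ¬S0 = record
    { g          = λ _ → 0
    ; increasing = λ _ ()
    ; complete   = λ { S0 z≤n → contradiction S0 ¬S0 }
    ; sound      = λ ()
    }

  listing-skip : ∀ {a n} → Listing S a n → ¬ S (suc a) → Listing S (suc a) n
  listing-skip {a} {n} L ¬Sa+1 = record
    { g          = g
    ; increasing = increasing
    ; complete   = λ Sx x≤a+1 → complete′ Sx (m<1+n⇒m<n∨m≡n (s≤s x≤a+1))
    ; sound      = map₂ m≤n⇒m≤1+n ∘ sound
    }
    where
    open Listing L
    complete′ : ∀ {x} → S x → x < suc a ⊎ x ≡ suc a → ∃[ i ] (i < n × g i ≡ x)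
    complete′ Sx (inj₁ x<a+1) = complete Sx (≤-pred x<a+1)
    complete′ Sx (inj₂ refl)  = contradiction Sx ¬Sa+1

  listing-snoc : ∀ {a n} → Listing S a n → S (suc a) → Listing S (suc a) (suc n)
  listing-snoc {a} {n} L Sa+1 = record
    { g          = g′
    ; increasing = λ i<j j<n+1 → increasing′ i<j (m<1+n⇒m<n∨m≡n j<n+1)
    ; complete   = λ Sx x≤a+1 → complete′ Sx (m<1+n⇒m<n∨m≡n (s≤s x≤a+1))
    ; sound      = sound′ ∘ m<1+n⇒m<n∨m≡n
    }
    where
    open Listing L

    g′ : ℕ → ℕ
    g′ i with i ≟ n
    ... | yes _ = suc a
    ... | no  _ = g i

    g′-old : ∀ {i} → i < n → g′ i ≡ g i
    g′-old {i} i<n with i ≟ n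
    ... | yes refl = contradiction i<n (n≮n i)
    ... | no  _    = refl

    g′-new : g′ n ≡ suc a
    g′-new with n ≟ n
    ... | yes _   = refl
    ... | no  n≢n = contradiction refl n≢n

    increasing′ : ∀ {i j} → i < j → j < n ⊎ j ≡ n → g′ i < g′ j
    increasing′ i<j (inj₁ j<n) =
      subst₂ _<_ (sym (g′-old (<-trans i<j j<n))) (sym (g′-old j<n)) (increasing i<j j<n)
    increasing′ i<n (inj₂ refl) =
      subst₂ _<_ (sym (g′-old i<n)) (sym g′-new) (s≤s (proj₂ (sound i<n)))

    complete′ : ∀ {x} → S x → x < suc a ⊎ x ≡ suc a → ∃[ i ] (i < suc n × g′ i ≡ x)
    complete′ Sx (inj₁ x<a+1) with complete Sx (≤-pred x<a+1)
    ... | i , i<n , gi≡x = i , m≤n⇒m≤1+n i<n , trans (g′-old i<n) gi≡x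
    complete′ Sx (inj₂ refl) = n , ≤-refl , g′-new

    sound′ : ∀ {i} → i < n ⊎ i ≡ n → S (g′ i) × g′ i ≤ suc a
    sound′ (inj₁ i<n) rewrite g′-old i<n = map₂ m≤n⇒m≤1+n (sound i<n)
    sound′ (inj₂ refl) rewrite g′-new    = Sa+1 , ≤-refl

  listing⇒nthSmallest : ∀ {a n} → S a → Listing S a n → NthSmallest S n a
  listing⇒nthSmallest {a} Sa L =
    Sa , g ∘ toℕ , (λ i j i<j → increasing i<j (toℕ<n j)) ,
    λ x → mk⇔ (listed x) λ { (i , refl) → sound (toℕ<n i) }
    where
    open Listing L
    listed : ∀ x → S x × x ≤ a → ∃[ i ] (g (toℕ i) ≡ x)
    listed x (Sx , x≤a) with complete Sx x≤a
    ... | i , i<n , gi≡x = fromℕ< i<n , trans (cong g (toℕ-fromℕ< i<n)) gi≡x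

module NonValues (P : ℕ → ℕ) (P-zero : P 0 ≡ 0) (P-step : ∀ m → P m < P (suc m)) where

  Value : ℕ → Set
  Value x = ∃[ m ] (1 ≤ m × P m ≡ x)

  NonValue : ℕ → Set
  NonValue x = 1 ≤ x × ¬ Value x

  P-mono-< : ∀ {i j} → i < j → P i < P j
  P-mono-< = mono′ ∘ <⇒<′
    where
    mono′ : ∀ {i j} → i <′ j → P i < P j
    mono′ <′-base        = P-step _
    mono′ (<′-step i<′j) = <-trans (mono′ i<′j) (P-step _)

  P-cancel-< : ∀ {i j} → P i < P j → i < j
  P-cancel-< {i} {j} Pi<Pj with <-cmp i j
  ... | tri< i<j _ _  = i<j
  ... | tri≈ _ refl _ = contradiction Pi<Pj (n≮n (P i))
  ... | tri> _ _ j<i  = contradiction Pi<Pj (<-asym (P-mono-< j<i))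

  between⇒nonValue : ∀ {c x} → P c < x → x < P (suc c) → NonValue x
  between⇒nonValue Pc<x x<Pc+1 = ≤-<-trans z≤n Pc<x , λ { (m , _ , refl) →
    <⇒≱ (P-cancel-< Pc<x) (≤-pred (P-cancel-< x<Pc+1)) }

  bracket-unique : ∀ {a i j} → P i ≤ a → a < P (suc i) → P j ≤ a → a < P (suc j) → i ≡ j
  bracket-unique Pi≤a a<Pi+1 Pj≤a a<Pj+1 = ≤-antisym
    (≤-pred (P-cancel-< (≤-<-trans Pi≤a a<Pj+1)))
    (≤-pred (P-cancel-< (≤-<-trans Pj≤a a<Pi+1)))

  nonValues-upTo : ∀ a → ∃₂ λ j n → P j ≤ a × a < P (suc j) × n + j ≡ a × Listing NonValue a n
  nonValues-upTo zero = 0 , 0 , ≤-reflexive P-zero , subst (_< P 1) P-zero (P-step 0) , refl ,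
    listing-zero λ { (() , _) }
  nonValues-upTo (suc a) with nonValues-upTo a
  ... | j , n , Pj≤a , a<Pj+1 , n+j≡a , L with suc a ≟ P (suc j)
  ...   | yes a+1≡Pj+1 = suc j , n , ≤-reflexive (sym a+1≡Pj+1) ,
    subst (_< P (2 + j)) (sym a+1≡Pj+1) (P-step (suc j)) , trans (+-suc n j) (cong suc n+j≡a) ,
    listing-skip L λ (_ , ¬value) → ¬value (suc j , s≤s z≤n , sym a+1≡Pj+1)
  ...   | no a+1≢Pj+1 = j , suc n , m≤n⇒m≤1+n Pj≤a , a+1<Pj+1 , cong suc n+j≡a ,
    listing-snoc L (between⇒nonValue (s≤s Pj≤a) a+1<Pj+1)
    where a+1<Pj+1 = ≤∧≢⇒< a<Pj+1 a+1≢Pj+1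

  between⇒nthSmallest : ∀ {n c a} → n + c ≡ a → P c < a → a < P (suc c) → NthSmallest NonValue n a
  between⇒nthSmallest {n} {c} {a} n+c≡a Pc<a a<Pc+1 with nonValues-upTo a
  ... | j , m , Pj≤a , a<Pj+1 , m+j≡a , L with bracket-unique Pj≤a a<Pj+1 (<⇒≤ Pc<a) a<Pc+1
  ... | refl with +-cancelʳ-≡ j m n (trans m+j≡a (sym n+c≡a))
  ... | refl = listing⇒nthSmallest (between⇒nonValue Pc<a a<Pc+1) L

-- The constant 3 is written as d + e, which makes these ring identities in free d and e.
numerator-step : ∀ d e m → suc m * (suc m + 1) * (suc m * d + e)
  ≡ suc m * (3 * m * d + 2 * (d + e)) + m * (m + 1) * (m * d + e)
numerator-step = solve-∀

numerator-split : ∀ d e t → suc t * (suc t + 1) * (suc t * d + e)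
  ≡ suc t * t * (suc t * d + d + (d + e)) + 2 * (d + e) * suc t
numerator-split = solve-∀

numerator-below-cube : ∀ d e t → t * (t + 1) * (t * d + e) + suc t * (t * (2 * d) + d)
  ≡ suc t * suc t * suc t * d + suc t * (t * e)
numerator-below-cube = solve-∀

numerator-above-cube : ∀ d e s → suc s * (suc s + 1) * (suc s * d + e)
  ≡ suc s * suc s * suc s * d + suc s * (suc s * (d + e) + e)
numerator-above-cube = solve-∀

module Pyramidal (d : ℕ) (1≤d : 1 ≤ d) (d≤3 : d ≤ 3) where

  -- e is written as in Defs, so that pyr k m unfolds to N m / 6.
  k e : ℕ
  k = 2 + d
  e = 5 ∸ k

  d+e≡3 : d + e ≡ 3
  d+e≡3 = m+[n∸m]≡n d≤3

  e≤2d : e ≤ 2 * d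
  e≤2d = +-cancelˡ-≤ d e (2 * d) (subst (_≤ 3 * d) (sym d+e≡3) (*-monoʳ-≤ 3 1≤d))

  N : ℕ → ℕ
  N m = m * (m + 1) * (m * d + e)

  Q : ℕ → ℕ
  Q s = s * (s ∸ 1) * (s * d + k + 1)

  N-step : ∀ m → 6 + N m ≤ N (suc m)
  N-step m = begin
    6 + N m                                  ≤⟨ +-monoˡ-≤ (N m) 6≤[m+1][3md+6] ⟩
    suc m * (3 * m * d + 6) + N m            ≡⟨ cong (λ x → suc m * (3 * m * d + 2 * x) + N m) d+e≡3 ⟨
    suc m * (3 * m * d + 2 * (d + e)) + N m  ≡⟨ numerator-step d e m ⟨
    N (suc m)                                ∎
    where
    open ≤-Reasoning
    6≤[m+1][3md+6] : 6 ≤ suc m * (3 * m * d + 6)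
    6≤[m+1][3md+6] = ≤-trans (m≤n+m 6 (3 * m * d)) (m≤m+n _ _)

  N-split : ∀ t → N (suc t) ≡ Q (suc t) + 6 * suc t
  N-split t = begin
    N (suc t)
      ≡⟨ numerator-split d e t ⟩
    suc t * t * (suc t * d + d + (d + e)) + 2 * (d + e) * suc t
      ≡⟨ cong (λ x → suc t * t * (suc t * d + d + x) + 2 * x * suc t) d+e≡3 ⟩
    suc t * t * (suc t * d + d + 3) + 6 * suc t
      ≡⟨ cong (λ x → suc t * t * x + 6 * suc t) regroup ⟩
    Q (suc t) + 6 * suc t
      ∎
    where
    open ≡-Reasoning
    regroup : suc t * d + d + 3 ≡ suc t * d + k + 1
    regroup = begin
      suc t * d + d + 3    ≡⟨ +-assoc (suc t * d) d 3 ⟩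
      suc t * d + (d + 3)  ≡⟨ cong (suc t * d +_) (+-comm d 3) ⟩
      suc t * d + (3 + d)  ≡⟨ cong (suc t * d +_) (+-comm 1 k) ⟩
      suc t * d + (k + 1)  ≡⟨ +-assoc (suc t * d) k 1 ⟨
      suc t * d + k + 1    ∎

  N<cube : ∀ t → N t < suc t ^ 3 * d
  N<cube t = +-cancelʳ-< (suc t * (t * e)) (N t) (suc t ^ 3 * d) (begin-strict
    N t + suc t * (t * e)                        <⟨ +-monoʳ-< (N t) (*-monoʳ-< (suc t) te<2td+d) ⟩
    N t + suc t * (t * (2 * d) + d)              ≡⟨ numerator-below-cube d e t ⟩
    suc t * suc t * suc t * d + suc t * (t * e)  ≡⟨ cong (λ x → x * d + suc t * (t * e)) (m^3≡m*m*m (suc t)) ⟨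
    suc t ^ 3 * d + suc t * (t * e)              ∎)
    where
    open ≤-Reasoning
    te<2td+d : t * e < t * (2 * d) + d
    te<2td+d = ≤-<-trans (*-monoʳ-≤ t e≤2d) (m<m+n (t * (2 * d)) 1≤d)

  cube+6s≤N : ∀ t → suc (suc t) ^ 3 * d + 6 * suc (suc t) ≤ N (suc (suc t))
  cube+6s≤N t = begin
    s ^ 3 * d + 6 * s                      ≡⟨ cong₂ _+_ (cong (_* d) (m^3≡m*m*m s)) (*-comm 6 s) ⟩
    s * s * s * d + s * 6                  ≤⟨ +-monoʳ-≤ (s * s * s * d) (*-monoʳ-≤ s (m≤m+n 6 (t * 3 + e))) ⟩
    s * s * s * d + s * (s * 3 + e)        ≡⟨ cong (λ x → s * s * s * d + s * (s * x + e)) d+e≡3 ⟨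
    s * s * s * d + s * (s * (d + e) + e)  ≡⟨ numerator-above-cube d e (suc t) ⟨
    N s                                    ∎
    where
    open ≤-Reasoning
    s = suc (suc t)

  unit-cube≤6n : ∀ {n} → 1 ≤ n → 1 ^ 3 * d ≤ 6 * n
  unit-cube≤6n 1≤n =
    ≤-trans (≤-reflexive (*-identityˡ d)) (≤-trans d≤3 (≤-trans (m≤m+n 3 3) (*-monoʳ-≤ 6 1≤n)))

  pyr-step : ∀ m → pyr k m < pyr k (suc m)
  pyr-step m = m*n≤o⇒m≤o/n (suc (pyr k m)) (≤-trans (+-monoʳ-≤ 6 (m/n*n≤m (N m) 6)) (N-step m))

  open NonValues (pyr k) refl pyr-step

  N<6a⇒pyr<a : ∀ c {a} → N c < 6 * a → pyr k c < a
  N<6a⇒pyr<a c {a} N<6a = m<n*o⇒m/o<n (subst (N c <_) (*-comm 6 a) N<6a)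

  6[1+a]≤N⇒a<pyr : ∀ c {a} → 6 * suc a ≤ N c → a < pyr k c
  6[1+a]≤N⇒a<pyr c {a} 6[1+a]≤N = m*n≤o⇒m≤o/n (suc a) (subst (_≤ N c) (*-comm 6 (suc a)) 6[1+a]≤N)

  6[1+n+s]≡6n+6[1+s] : ∀ n s → 6 * suc (n + s) ≡ 6 * n + 6 * suc s
  6[1+n+s]≡6n+6[1+s] n s = trans (cong (6 *_) (sym (+-suc n s))) (*-distribˡ-+ 6 n (suc s))

  nthSmallest-below : ∀ {n t} → suc t ^ 3 * d ≤ 6 * n → 6 * n ≤ Q (suc t) →
                      NthSmallest NonValue n (n + t)
  nthSmallest-below {n} {t} cube≤6n 6n≤Q = between⇒nthSmallest refl
    (<-≤-trans (N<6a⇒pyr<a t (<-≤-trans (N<cube t) cube≤6n)) (m≤m+n n t))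
    (6[1+a]≤N⇒a<pyr (suc t) (begin
      6 * suc (n + t)        ≡⟨ 6[1+n+s]≡6n+6[1+s] n t ⟩
      6 * n + 6 * suc t      ≤⟨ +-monoˡ-≤ (6 * suc t) 6n≤Q ⟩
      Q (suc t) + 6 * suc t  ≡⟨ N-split t ⟨
      N (suc t)              ∎))
    where open ≤-Reasoning

  nthSmallest-above : ∀ {n t} → 6 * n < suc (suc t) ^ 3 * d → Q (suc t) < 6 * n →
                      NthSmallest NonValue n (n + suc t)
  nthSmallest-above {n} {t} 6n<cube Q<6n = between⇒nthSmallest refl
    (N<6a⇒pyr<a (suc t) (begin-strict
      N (suc t)                              ≡⟨ N-split t ⟩
      Q (suc t) + 6 * suc t                  <⟨ +-monoˡ-< (6 * suc t) Q<6n ⟩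
      6 * n + 6 * suc t                      ≡⟨ *-distribˡ-+ 6 n (suc t) ⟨
      6 * (n + suc t)                        ∎))
    (6[1+a]≤N⇒a<pyr (suc (suc t)) (begin
      6 * suc (n + suc t)                    ≡⟨ 6[1+n+s]≡6n+6[1+s] n (suc t) ⟩
      6 * n + 6 * suc (suc t)                ≤⟨ +-monoˡ-≤ (6 * suc (suc t)) (<⇒≤ 6n<cube) ⟩
      suc (suc t) ^ 3 * d + 6 * suc (suc t)  ≤⟨ cube+6s≤N t ⟩
      N (suc (suc t))                        ∎))
    where open ≤-Reasoning

corollary4 : (k n s : ℕ) → 3 ≤ k → k ≤ 5 → 1 ≤ n →
    s ^ 3 * (k ∸ 2) ≤ 6 * n → 6 * n < suc s ^ 3 * (k ∸ 2) →
    (6 * n ≤ s * (s ∸ 1) * (s * (k ∸ 2) + k + 1) → NthSmallest (NonPyramidal k) n (n + s ∸ 1)) ×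
    (¬ (6 * n ≤ s * (s ∸ 1) * (s * (k ∸ 2) + k + 1)) → NthSmallest (NonPyramidal k) n (n + s))
corollary4 (suc (suc d)) n zero (s≤s (s≤s 1≤d)) (s≤s (s≤s d≤3)) 1≤n _ 6n<d =
  contradiction 6n<d (≤⇒≯ (Pyramidal.unit-cube≤6n d 1≤d d≤3 1≤n))
corollary4 (suc (suc d)) n (suc t) (s≤s (s≤s 1≤d)) (s≤s (s≤s d≤3)) _ cube≤6n 6n<cube =
    (λ 6n≤Q → subst (NthSmallest (NonPyramidal k) n) (sym (+-∸-assoc n (s≤s z≤n)))
                     (nthSmallest-below cube≤6n 6n≤Q))
  , (λ 6n≰Q → nthSmallest-above 6n<cube (≰⇒> 6n≰Q))
  where open Pyramidal d 1≤d d≤3
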